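{- Let $\mathcal{A}$ and $\mathcal{B}$ be shifted cross $t$-intersecting families in $\binom{[n]}{k}$ with $|\mathcal{A}||\mathcal{B}|>0$. Then $\lambda(\mathcal{A})+\lambda(\mathcal{B})\geq 2t$.
   Context: $\binom{[n]}{k}$ is the set of $k$-subsets of $[n]$. A family $\mathcal{A}$ is shifted if whenever $1\le i<j\le n$, $A\in\mathcal{A}$ and $A\cap\{i,j\}=\{j\}$, then $(A\setminus\{j\})\cup\{i\}\in\mathcal{A}$. Cross $t$-intersecting: $|A\cap B|\ge t$ for all $A\in\mathcal{A},B\in\mathcal{B}$. To $F\subset[n]$ associate the lattice walk from $(0,0)$ whose $i$-th step is up if $i\in F$ and right otherwise; it hits the line $y=x+c$ iff $2|F\cap[j]|=j+c$ for some $0\le j\le n$ (with $[0]=\emptyset$). For a nonempty family $\mathcal{F}$, $\lambda(\mathcal{F})$ is the maximum $\lambda$ such that the walks of all members of $\mathcal{F}$ hit the line $y=x+\lambda$. -}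

module Defs where

open import Data.Nat using (ℕ; _<ᵇ_; _*_; _≤_)
open import Data.Integer using (ℤ; +_; _+_)
open import Data.Fin using (Fin; toℕ; _<_)
open import Data.Fin.Subset using (Subset; inside; outside; _∈_; _∉_; _∩_; ∣_∣)
open import Data.Vec using (tabulate; _[_]≔_)
open import Data.Product using (Σ; ∃; _×_)
open import Relation.Binary.PropositionalEquality using (_≡_)

-- A family of subsets of [n] (elements of [n] are Fin n, i.e. 0..n-1 standing for 1..n)
Family : ℕ → Set₁
Family n = Subset n → Set

Uniform : ∀ {n} → ℕ → Family n → Set
Uniform k 𝒜 = ∀ A → 𝒜 A → ∣ A ∣ ≡ k

swapIn : ∀ {n} → Subset n → Fin n → Fin n → Subset n
swapIn A j i = (A [ j ]≔ outside) [ i ]≔ inside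

Shifted : ∀ {n} → Family n → Set
Shifted 𝒜 = ∀ i j A → i < j → 𝒜 A → j ∈ A → i ∉ A → 𝒜 (swapIn A j i)

CrossIntersecting : ∀ {n} → ℕ → Family n → Family n → Set
CrossIntersecting t 𝒜 ℬ = ∀ A B → 𝒜 A → ℬ B → t ≤ ∣ A ∩ B ∣

NonEmpty : ∀ {n} → Family n → Set
NonEmpty 𝒜 = ∃ λ A → 𝒜 A

prefix : ∀ {n} → ℕ → Subset n
prefix j = tabulate (λ i → if toℕ i <ᵇ j then inside else outside)
  where
  open import Data.Bool using (if_then_else_)

-- the walk of F hits y = x + c  iff  2|F ∩ [j]| = j + c for some 0 ≤ j ≤ n
Hits : ∀ {n} → Subset n → ℤ → Set
Hits {n} F c = Σ ℕ λ j → (j ≤ n) × (+ (2 * ∣ F ∩ prefix j ∣) ≡ + j + c)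

AllHit : ∀ {n} → Family n → ℤ → Set
AllHit 𝒜 c = ∀ F → 𝒜 F → Hits F c

IsLambda : ∀ {n} → Family n → ℤ → Set
IsLambda 𝒜 l = AllHit 𝒜 l × (∀ c → AllHit 𝒜 c → c Data.Integer.≤ l)

-- A member of 𝒜 whose walk never rises above y = x + λ(𝒜) can, by left shifts, be turned into
-- the greedy walk that climbs straight to that line and then zigzags along it, so by shiftedness
-- this greedy set lies in 𝒜; likewise for ℬ. Two greedy walks below the lines y = x + g and
-- y = x + g' with g + g' odd share at most (g + g' − 1)/2 up-steps. Raising λ(ℬ) by one if
-- necessary to make the sum odd gives 2t ≤ λ(𝒜) + λ(ℬ).
module Submission where

open import Defs
open import Data.Bool using (Bool; true; false)
open import Data.Vec using ([]; _∷_; _[_]=_; here; there; _[_]≔_)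
open import Data.Fin using (Fin) renaming (zero to fzero; suc to fsuc)
open import Data.Fin.Subset using (Subset; _∩_; ∣_∣) renaming (⊥ to ∅)
open import Data.Fin.Subset.Properties using (∣p∩q∣≤∣p∣; ∣p∩q∣≤∣q∣; ∣⊥∣≡0)
open import Data.Product using (Σ; ∃; _×_; _,_)
open import Data.Sum using (_⊎_; inj₁; inj₂; [_,_]′; map)
open import Data.Empty using (⊥-elim)
open import Function using (_∘_; id)
open import Relation.Nullary using (¬_)
open import Relation.Nullary.Decidable using (decidable-stable)
open import Relation.Binary.PropositionalEquality using (_≡_; refl; sym; trans; cong; subst; module ≡-Reasoning)

open import Data.Nat using (ℕ; _*_)

variable
  n d g k t α β : ℕ
  A B C : Subset n
  𝒜 ℬ : Family n

module Walks where
  open import Data.Nat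
    using (zero; suc; _+_; _≤_; z≤n; s≤s)
  open import Data.Nat.Properties
    using (+-suc; +-identityʳ; *-suc; suc-injective; ≤-trans; n≤1+n; *-monoʳ-≤)
  open import Data.Nat.Tactic.RingSolver using (solve-∀)

  -- Dominates d C A: in the part read so far C has d more elements than A; reading on, C never
  -- falls behind A and the two end level. So Dominates 0 C A says |C ∩ [j]| ≥ |A ∩ [j]| for all j
  -- and |C| = |A|, i.e. C arises from A by left shifts.
  data Dominates : ℕ → Subset n → Subset n → Set where
    []      : Dominates 0 [] []
    both    : Dominates d C A → Dominates d (true ∷ C) (true ∷ A)
    neither : Dominates d C A → Dominates d (false ∷ C) (false ∷ A)
    ahead   : Dominates (suc d) C A → Dominates d (true ∷ C) (false ∷ A)
    behind  : Dominates d C A → Dominates (suc d) (false ∷ C) (true ∷ A)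

  dominates-remove : Dominates (suc d) C A →
                     Σ (Fin n) λ j → A [ j ]= true × Dominates d C (A [ j ]≔ false)
  dominates-remove (both C≽A) = fzero , here , ahead C≽A
  dominates-remove (behind C≽A) = fzero , here , neither C≽A
  dominates-remove (neither C≽A) with j , j∈A , C≽A-j ← dominates-remove C≽A =
    fsuc j , there j∈A , neither C≽A-j
  dominates-remove (ahead C≽A) with j , j∈A , C≽A-j ← dominates-remove C≽A =
    fsuc j , there j∈A , ahead C≽A-j

  shifted-∷ : (x : Bool) → Shifted 𝒜 → Shifted (𝒜 ∘ (x ∷_))
  shifted-∷ x shifted i j A i<j A∈𝒜 j∈A i∉A =
    shifted (fsuc i) (fsuc j) (x ∷ A) (s≤s i<j) A∈𝒜 (there j∈A) λ { (there i∈A) → i∉A i∈A }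

  shifted-dominates-closed : Shifted 𝒜 → Dominates 0 C A → 𝒜 A → 𝒜 C
  shifted-dominates-closed sh [] A∈𝒜 = A∈𝒜
  shifted-dominates-closed sh (both C≽A) A∈𝒜 =
    shifted-dominates-closed (shifted-∷ true sh) C≽A A∈𝒜
  shifted-dominates-closed sh (neither C≽A) A∈𝒜 =
    shifted-dominates-closed (shifted-∷ false sh) C≽A A∈𝒜
  -- A's surplus element j + 1, found by dominates-remove, is shifted to the front.
  shifted-dominates-closed {A = false ∷ A} sh (ahead C≽A) A∈𝒜
    with j , j∈A , C≽A-j ← dominates-remove C≽A =
    shifted-dominates-closed (shifted-∷ true sh) C≽A-j
      (sh fzero (fsuc j) (false ∷ A) (s≤s z≤n) A∈𝒜 (there j∈A) λ ())

  -- Below g F: the walk of F never rises more than g above its starting height.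
  data Below : ℕ → Subset n → Set where
    []         : Below g []
    step-up    : Below g A → Below (suc g) (true ∷ A)
    step-right : Below (suc g) A → Below g (false ∷ A)

  below-suc : Below g A → Below (suc g) A
  below-suc [] = []
  below-suc (step-up below) = step-up (below-suc below)
  below-suc (step-right below) = step-right (below-suc below)

  -- greedy g r n: the walk of length n with (at most) r up-steps that steps up whenever this
  -- keeps it within g of its starting height.
  greedy : ℕ → ℕ → (n : ℕ) → Subset n
  greedy g zero n = ∅
  greedy g (suc r) zero = []
  greedy zero (suc r) (suc n) = false ∷ greedy 1 (suc r) n
  greedy (suc g) (suc r) (suc n) = true ∷ greedy g r n

  ∅-dominates : (A : Subset n) → Dominates ∣ A ∣ ∅ A
  ∅-dominates [] = []
  ∅-dominates (true ∷ A) = behind (∅-dominates A)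
  ∅-dominates (false ∷ A) = neither (∅-dominates A)

  -- The greedy walk is d elements, hence 2d steps of height, ahead of A; h ≡ g + 2 * d says
  -- that both are bounded by the same line.
  greedy-dominates : ∀ {h} g r d → Below h A → h ≡ g + 2 * d → ∣ A ∣ ≡ r + d →
                     Dominates d (greedy g r n) A
  greedy-dominates {A = A} g zero d _ _ refl = ∅-dominates A
  greedy-dominates {A = []} g (suc r) d [] _ ()
  greedy-dominates zero (suc r) zero (step-up _) () _
  greedy-dominates zero (suc r) (suc d) (step-up below) h≡ ∣A∣≡ =
    behind (greedy-dominates 1 (suc r) d below
      (suc-injective (trans h≡ (*-suc 2 d))) (trans (suc-injective ∣A∣≡) (+-suc r d)))
  greedy-dominates zero (suc r) d (step-right below) h≡ ∣A∣≡ =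
    neither (greedy-dominates 1 (suc r) d below (cong suc h≡) ∣A∣≡)
  greedy-dominates (suc g) (suc r) d (step-up below) h≡ ∣A∣≡ =
    both (greedy-dominates g r d below (suc-injective h≡) (suc-injective ∣A∣≡))
  greedy-dominates (suc g) (suc r) d (step-right below) h≡ ∣A∣≡ =
    ahead (greedy-dominates g r (suc d) below
      (trans (cong suc h≡) (suc-suc-+ g d)) (trans ∣A∣≡ (sym (+-suc r d))))
    where
    suc-suc-+ : ∀ g d → suc (suc g + 2 * d) ≡ g + 2 * suc d
    suc-suc-+ = solve-∀

  ∣∅∣≤ : ∀ n s → ∣ ∅ {n} ∣ ≤ s
  ∣∅∣≤ n s = subst (_≤ s) (sym (∣⊥∣≡0 n)) z≤n

  -- While both walks still have up-steps, g + g' stays odd, so they are never both at their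
  -- ceilings and g + g' never grows; each common up-step lowers it by 2.
  greedy-∩ : ∀ n g g' r r' s → g + g' ≡ suc (s + s) → ∣ greedy g r n ∩ greedy g' r' n ∣ ≤ s
  greedy-∩ n g g' zero r' s _ = ≤-trans (∣p∩q∣≤∣p∣ ∅ (greedy g' r' n)) (∣∅∣≤ n s)
  greedy-∩ n g g' (suc r) zero s _ = ≤-trans (∣p∩q∣≤∣q∣ (greedy g (suc r) n) ∅) (∣∅∣≤ n s)
  greedy-∩ zero g g' (suc r) (suc r') s _ = z≤n
  greedy-∩ (suc n) zero zero (suc r) (suc r') s ()
  greedy-∩ (suc n) zero (suc g') (suc r) (suc r') s odd = greedy-∩ n 1 g' (suc r) r' s odd
  greedy-∩ (suc n) (suc g) zero (suc r) (suc r') s odd =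
    greedy-∩ n g 1 r (suc r') s (trans (+-suc g 0) odd)
  greedy-∩ (suc n) (suc g) (suc g') (suc r) (suc r') s odd
    with s | trans (sym (+-suc g g')) (suc-injective odd)
  ... | zero  | ()
  ... | suc s | odd′ =
    s≤s (greedy-∩ n g g' r r' s (suc-injective (trans odd′ (cong suc (+-suc s s)))))

  greedy-member : Uniform k 𝒜 → Shifted 𝒜 → 𝒜 A → Below g A → 𝒜 (greedy g k n)
  greedy-member {k = k} {A = A} {g = g} uniform shifted A∈𝒜 below =
    shifted-dominates-closed shifted
      (greedy-dominates g k 0 below (sym (+-identityʳ g))
        (trans (uniform A A∈𝒜) (sym (+-identityʳ k))))
      A∈𝒜

  even-or-odd : ∀ m → ∃ λ s → m ≡ s + s ⊎ m ≡ suc (s + s)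
  even-or-odd zero = 0 , inj₁ refl
  even-or-odd (suc m) with even-or-odd m
  ... | s , inj₁ even = s , inj₂ (cong suc even)
  ... | s , inj₂ odd = suc s , inj₁ (trans (cong suc odd) (cong suc (sym (+-suc s s))))

  double-mono : ∀ s → t ≤ s → 2 * t ≤ s + s
  double-mono {t = t} s t≤s = subst (2 * t ≤_) (cong (s +_) (+-identityʳ s)) (*-monoʳ-≤ 2 t≤s)

  module _ {k t} {𝒜 ℬ : Family n} (uniform𝒜 : Uniform k 𝒜) (uniformℬ : Uniform k ℬ)
           (shifted𝒜 : Shifted 𝒜) (shiftedℬ : Shifted ℬ) (cross : CrossIntersecting t 𝒜 ℬ) where

    cross-below-odd : ∀ {g g'} s → g + g' ≡ suc (s + s) →
                      𝒜 A → Below g A → ℬ B → Below g' B → t ≤ s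
    cross-below-odd {g = g} {g'} s odd A∈𝒜 A-below B∈ℬ B-below =
      ≤-trans (cross _ _ (greedy-member uniform𝒜 shifted𝒜 A∈𝒜 A-below)
                         (greedy-member uniformℬ shiftedℬ B∈ℬ B-below))
              (greedy-∩ n g g' k k s odd)

    cross-below : 𝒜 A → Below α A → ℬ B → Below β B → 2 * t ≤ α + β
    cross-below {α = α} {β = β} A∈𝒜 A-below B∈ℬ B-below with even-or-odd (α + β)
    ... | s , inj₁ even =
      subst (2 * t ≤_) (sym even) (double-mono s
        (cross-below-odd s (trans (+-suc α β) (cong suc even)) A∈𝒜 A-below B∈ℬ (below-suc B-below)))
    ... | s , inj₂ odd =
      ≤-trans (double-mono s (cross-below-odd s odd A∈𝒜 A-below B∈ℬ B-below))
              (subst (s + s ≤_) (sym odd) (n≤1+n (s + s)))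

module Lambda where
  open import Data.Nat using (zero; suc; _+_; z≤n; s≤s)
  open import Data.Nat.Properties using (+-suc; *-suc; 1+n≰n)
  open import Data.Integer using (+_; -[1+_])
  open import Data.Integer.Properties using (+-injective; drop‿+≤+)
  open ≡-Reasoning
  open Walks using (Below; []; step-up; step-right)

  ∩-prefix-zero : (F : Subset n) → ∣ F ∩ prefix 0 ∣ ≡ 0
  ∩-prefix-zero [] = refl
  ∩-prefix-zero (true ∷ F) = ∩-prefix-zero F
  ∩-prefix-zero (false ∷ F) = ∩-prefix-zero F

  hits-diagonal : (F : Subset n) → Hits F (+ 0)
  hits-diagonal F = 0 , z≤n , cong (λ m → + (2 * m)) (∩-prefix-zero F)

  -- On x ∷ F, prefix (suc j) is inside ∷ prefix j definitionally, so a hit of F at step j is a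
  -- hit of x ∷ F at step j + 1.
  hits-∷-true : ∀ (F : Subset n) c → Hits F (+ c) → Hits (true ∷ F) (+ suc c)
  hits-∷-true F c (j , j≤n , hit) = suc j , s≤s j≤n , cong +_ (begin
    2 * suc m          ≡⟨ *-suc 2 m ⟩
    suc (suc (2 * m))  ≡⟨ cong (suc ∘ suc) (+-injective hit) ⟩
    suc (suc (j + c))  ≡⟨ cong suc (sym (+-suc j c)) ⟩
    suc j + suc c      ∎)
    where m = ∣ F ∩ prefix j ∣

  hits-∷-false : ∀ (F : Subset n) c → Hits F (+ suc c) → Hits (false ∷ F) (+ c)
  hits-∷-false F c (j , j≤n , hit) = suc j , s≤s j≤n , cong +_ (trans (+-injective hit) (+-suc j c))

  hits-or-below : (F : Subset n) (g : ℕ) → Hits F (+ suc g) ⊎ Below g F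
  hits-or-below [] g = inj₂ []
  hits-or-below (true ∷ F) zero = inj₁ (hits-∷-true F 0 (hits-diagonal F))
  hits-or-below (true ∷ F) (suc g) = map (hits-∷-true F (suc g)) step-up (hits-or-below F g)
  hits-or-below (false ∷ F) g = map (hits-∷-false F (suc g)) step-right (hits-or-below F (suc g))

  lambda-natural : ∀ {l} → IsLambda 𝒜 l → ∃ λ α → l ≡ + α
  lambda-natural {l = + α} _ = α , refl
  lambda-natural {l = -[1+ _ ]} (_ , maximal) with () ← maximal (+ 0) (λ F _ → hits-diagonal F)

  -- Constructively, λ(𝒜) = α only yields a member staying below y = x + α as a double negation.
  lambda-attained : IsLambda 𝒜 (+ α) → ¬ (∀ A → 𝒜 A → ¬ Below α A)
  lambda-attained {α = α} (_ , maximal) never-below =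
    1+n≰n (drop‿+≤+ (maximal (+ suc α) λ A A∈𝒜 →
      [ id , ⊥-elim ∘ never-below A A∈𝒜 ]′ (hits-or-below A α)))

open import Data.Integer using (ℤ; +_; _+_; _≥_; +≤+)
import Data.Nat as ℕ
open Walks using (cross-below)
open Lambda using (lambda-natural; lambda-attained)

-- The NonEmpty hypotheses are redundant: IsLambda fails for the empty family, where every c
-- qualifies.
lemma2p17 : (n k t : ℕ) (𝒜 ℬ : Family n) →
    Uniform k 𝒜 → Uniform k ℬ → Shifted 𝒜 → Shifted ℬ →
    CrossIntersecting t 𝒜 ℬ → NonEmpty 𝒜 → NonEmpty ℬ →
    (lA lB : ℤ) → IsLambda 𝒜 lA → IsLambda ℬ lB →
    lA + lB ≥ + (2 * t)
lemma2p17 n k t 𝒜 ℬ uniform𝒜 uniformℬ shifted𝒜 shiftedℬ cross _ _ lA lB 𝒜-lambda ℬ-lambda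
  with α , refl ← lambda-natural 𝒜-lambda | β , refl ← lambda-natural ℬ-lambda =
  +≤+ (decidable-stable (2 * t ℕ.≤? α ℕ.+ β) λ 2t≰α+β →
    lambda-attained 𝒜-lambda λ A A∈𝒜 A-below →
    lambda-attained ℬ-lambda λ B B∈ℬ B-below →
    2t≰α+β (cross-below uniform𝒜 uniformℬ shifted𝒜 shiftedℬ cross A∈𝒜 A-below B∈ℬ B-below))
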